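{- Let $k\ge 1$, let $T$ be a non-negative integer, and let $Z_1,\dots,Z_k$ be finite sets of integers with $Z_i\subseteq[0,T]$. Let $G^*$ be the directed multigraph with vertices $s=v_0,v_1,\dots,v_k=t$ in which, for each $i\in\{1,\dots,k\}$ and each $z\in Z_i$, there is an edge from $v_{i-1}$ to $v_i$ of length $z$ and cost $T-z$. Then there exist $z_1\in Z_1,\dots,z_k\in Z_k$ with $z_1+\dots+z_k=T$ if and only if $G^*$ has an $s,t$-path of total length at most $L=T$ and total cost at most $C=T(k-1)$. -}

module Defs where

open import Data.Nat using (ℕ; suc)
open import Data.Fin using (Fin; zero; suc; inject₁; fromℕ)
open import Data.Integer using (ℤ; +_; _-_; _+_; _*_)
open import Data.List using (List; []; _∷_; foldr; map)
open import Data.List.Membership.Propositional using (_∈_)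
open import Relation.Binary.PropositionalEquality using (_≡_)

-- Vertices: Fin (suc k), where vertex j is v_j; s = v₀ = zero, t = v_k = fromℕ k.
-- Edges: for each i (here i : Fin k stands for the paper's index i+1) and each
-- z ∈ Z_i there is an edge from v_{i-1} (= inject₁ i) to v_i (= suc i).
-- Z i is a list (finite set) of integers; duplicates would only duplicate
-- parallel edges with identical length/cost.
record Edge (k : ℕ) (Z : Fin k → List ℤ) : Set where
  constructor edge
  field
    layer : Fin k
    value : ℤ
    value∈ : value ∈ Z layer

module _ {k : ℕ} {Z : Fin k → List ℤ} where

  source : Edge k Z → Fin (suc k)
  source e = inject₁ (Edge.layer e)

  target : Edge k Z → Fin (suc k)
  target e = suc (Edge.layer e)

  edgeLength : Edge k Z → ℤ
  edgeLength e = Edge.value e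

  edgeCost : ℤ → Edge k Z → ℤ
  edgeCost T e = T - Edge.value e

  data Path : Fin (suc k) → Fin (suc k) → Set where
    [] : ∀ {u} → Path u u
    _∷_ : ∀ {w} (e : Edge k Z) → Path (target e) w → Path (source e) w

  pathLength : ∀ {u w} → Path u w → ℤ
  pathLength [] = + 0
  pathLength (e ∷ p) = edgeLength e + pathLength p

  pathCost : ℤ → ∀ {u w} → Path u w → ℤ
  pathCost T [] = + 0
  pathCost T (e ∷ p) = edgeCost T e + pathCost T p

sumFin : ∀ {k} → (Fin k → ℤ) → ℤ
sumFin {ℕ.zero} f = + 0
sumFin {suc k} f = f zero + sumFin (λ i → f (suc i))

-- Every edge has length + cost = T, so every s,t-path (which has exactly k edges) has
-- length + cost = T k. Hence the cost bound T (k − 1) is equivalent to length ≥ T, and the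
-- two budgets together say that the length is exactly T. Finally, s,t-paths are the same
-- thing as choices z₁ ∈ Z₁, …, z_k ∈ Z_k, with the length of the path being z₁ + ⋯ + z_k.
module Submission where

open import Defs
open import Data.Nat as ℕ using (ℕ; suc; _≥_)
open import Data.Nat.Properties using (+-suc; +-identityʳ)
open import Data.Fin using (Fin; zero; toℕ; fromℕ)
import Data.Fin as Fin
open import Data.Fin.Properties using (toℕ-inject₁; toℕ-fromℕ)
open import Data.Integer using (ℤ; +_; _≤_; _*_; _-_; _+_; 0ℤ; 1ℤ)
open import Data.Integer.Properties using (*-zeroʳ; ≤-antisym; ≤-reflexive; i≤j⇒0≤j-i; 0≤i-j⇒j≤i)
open import Data.Integer.Tactic.RingSolver using (solve-∀)
open import Data.List using (List)
open import Data.List.Membership.Propositional using (_∈_)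
open import Data.Product using (Σ; _×_; _,_)
open import Function.Base using (_∘_)
open import Function.Bundles using (_⇔_; mk⇔; Equivalence)
open import Relation.Binary.PropositionalEquality
  using (_≡_; refl; sym; trans; cong; cong₂; subst; module ≡-Reasoning)

open ≡-Reasoning

module _ {k : ℕ} {Z : Fin k → List ℤ} where

  size : ∀ {u w} → Path {k} {Z} u w → ℕ
  size []      = 0
  size (_ ∷ p) = suc (size p)

  toℕ-end≡size+toℕ-start : ∀ {u w} (p : Path {k} {Z} u w) → toℕ w ≡ size p ℕ.+ toℕ u
  toℕ-end≡size+toℕ-start [] = refl
  toℕ-end≡size+toℕ-start (edge i _ _ ∷ p) = begin
    _                         ≡⟨ toℕ-end≡size+toℕ-start p ⟩
    size p ℕ.+ suc (toℕ i)    ≡⟨ +-suc (size p) (toℕ i) ⟩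
    suc (size p ℕ.+ toℕ i)    ≡⟨ cong (λ j → suc (size p ℕ.+ j)) (sym (toℕ-inject₁ i)) ⟩
    _                         ∎

  size-stPath : (p : Path {k} {Z} zero (fromℕ k)) → size p ≡ k
  size-stPath p = begin
    size p          ≡⟨ sym (+-identityʳ (size p)) ⟩
    size p ℕ.+ 0    ≡⟨ sym (toℕ-end≡size+toℕ-start p) ⟩
    toℕ (fromℕ k)   ≡⟨ toℕ-fromℕ k ⟩
    k               ∎

  edgeCost+edgeLength : ∀ T (e : Edge k Z) → edgeCost T e + edgeLength e ≡ T
  edgeCost+edgeLength T e = minus-plus T (Edge.value e)
    where
    minus-plus : ∀ t z → (t - z) + z ≡ t
    minus-plus = solve-∀

  pathCost+pathLength : ∀ T {u w} (p : Path {k} {Z} u w) →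
                        pathCost T p + pathLength p ≡ T * + size p
  pathCost+pathLength T [] = sym (*-zeroʳ T)
  pathCost+pathLength T (e ∷ p) = begin
    (edgeCost T e + pathCost T p) + (edgeLength e + pathLength p)
      ≡⟨ interchange (edgeCost T e) _ _ _ ⟩
    (edgeCost T e + edgeLength e) + (pathCost T p + pathLength p)
      ≡⟨ cong₂ _+_ (edgeCost+edgeLength T e) (pathCost+pathLength T p) ⟩
    T + T * + size p
      ≡⟨ factor T (+ size p) ⟩
    T * (1ℤ + + size p)
      ∎
    where
    interchange : ∀ a b c d → (a + b) + (c + d) ≡ (a + c) + (b + d)
    interchange = solve-∀
    factor : ∀ t n → t + t * n ≡ t * (1ℤ + n)
    factor = solve-∀

  pathCost+pathLength-stPath : ∀ T (p : Path {k} {Z} zero (fromℕ k)) →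
                               pathCost T p + pathLength p ≡ T * + k
  pathCost+pathLength-stPath T p =
    subst (λ n → pathCost T p + pathLength p ≡ T * + n) (size-stPath p) (pathCost+pathLength T p)

module _ {k : ℕ} {Z : Fin (suc k) → List ℤ} where

  liftPath : ∀ {u w} → Path {k} {Z ∘ Fin.suc} u w → Path {suc k} {Z} (Fin.suc u) (Fin.suc w)
  liftPath []                = []
  liftPath (edge i z z∈ ∷ p) = edge (Fin.suc i) z z∈ ∷ liftPath p

  pathLength-liftPath : ∀ {u w} (p : Path {k} {Z ∘ Fin.suc} u w) →
                        pathLength (liftPath p) ≡ pathLength p
  pathLength-liftPath []               = refl
  pathLength-liftPath (edge _ z _ ∷ p) = cong (_+_ z) (pathLength-liftPath p)

  -- Endpoints are passed as equations here and in choiceOfPath: the source index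
  -- inject₁ i of an edge does not unify with a constructor pattern.
  lowerPath : ∀ {a b u w} (p : Path {suc k} {Z} a b) → a ≡ Fin.suc u → b ≡ Fin.suc w →
              Σ (Path {k} {Z ∘ Fin.suc} u w) (λ q → pathLength q ≡ pathLength p)
  lowerPath [] refl refl = [] , refl
  lowerPath (edge zero _ _ ∷ _) () _
  lowerPath (edge (Fin.suc i) z z∈ ∷ p) refl b≡ with lowerPath p refl b≡
  ... | q , q≡p = edge i z z∈ ∷ q , cong (_+_ z) q≡p

pathOfChoice : ∀ {k} {Z : Fin k → List ℤ} (zs : Fin k → ℤ) → (∀ i → zs i ∈ Z i) →
               Σ (Path {k} {Z} zero (fromℕ k)) (λ p → pathLength p ≡ sumFin zs)
pathOfChoice {ℕ.zero} zs zs∈ = [] , refl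
pathOfChoice {suc k} {Z} zs zs∈ with pathOfChoice (zs ∘ Fin.suc) (zs∈ ∘ Fin.suc)
... | p , p≡ = edge zero (zs zero) (zs∈ zero) ∷ liftPath p
             , cong (_+_ (zs zero)) (trans (pathLength-liftPath {Z = Z} p) p≡)

choiceOfPath : ∀ {k} {Z : Fin k → List ℤ} {a b} (p : Path {k} {Z} a b) → a ≡ zero → b ≡ fromℕ k →
               Σ (Fin k → ℤ) (λ zs → (∀ i → zs i ∈ Z i) × sumFin zs ≡ pathLength p)
choiceOfPath {ℕ.zero} [] refl refl = (λ ()) , (λ ()) , refl
choiceOfPath {ℕ.zero} (edge () _ _ ∷ _)
choiceOfPath {suc k} [] refl ()
choiceOfPath {suc k} (edge (Fin.suc _) _ _ ∷ _) () _
choiceOfPath {suc k} (edge zero z z∈ ∷ p) refl b≡ with lowerPath p refl b≡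
... | q , q≡p with choiceOfPath q refl refl
... | zs , zs∈ , zs≡q = (λ { zero → z ; (Fin.suc i) → zs i })
                      , (λ { zero → z∈ ; (Fin.suc i) → zs∈ i })
                      , cong (_+_ z) (trans zs≡q q≡p)

cost≤⇔length≥ : ∀ {c l t k : ℤ} → c + l ≡ t * k → (c ≤ t * (k - 1ℤ) ⇔ t ≤ l)
cost≤⇔length≥ {c} {l} {t} {k} c+l≡tk =
  mk⇔ (λ c≤ → 0≤i-j⇒j≤i (subst (0ℤ ≤_) slack (i≤j⇒0≤j-i c≤)))
      (λ t≤l → 0≤i-j⇒j≤i (subst (0ℤ ≤_) (sym slack) (i≤j⇒0≤j-i t≤l)))
  where
  slack : t * (k - 1ℤ) - c ≡ l - t
  slack = begin
    t * (k - 1ℤ) - c                   ≡⟨ split t k c l ⟩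
    (t * k - (c + l)) + (l - t)        ≡⟨ cong (λ x → (x - (c + l)) + (l - t)) (sym c+l≡tk) ⟩
    ((c + l) - (c + l)) + (l - t)      ≡⟨ cancel (c + l) (l - t) ⟩
    l - t                              ∎
    where
    split : ∀ t k c l → t * (k - 1ℤ) - c ≡ (t * k - (c + l)) + (l - t)
    split = solve-∀
    cancel : ∀ x y → (x - x) + y ≡ y
    cancel = solve-∀

lemma5 : (k : ℕ) → k ≥ 1 → (T : ℕ) → (Z : Fin k → List ℤ) →
    (∀ i z → z ∈ Z i → (+ 0 ≤ z × z ≤ + T)) →
    (Σ (Fin k → ℤ) (λ zs → (∀ i → zs i ∈ Z i) × sumFin zs ≡ + T))
    ⇔
    (Σ (Path {k} {Z} zero (fromℕ k)) (λ p →
    (pathLength p ≤ + T) × (pathCost (+ T) p ≤ + T * (+ k - + 1))))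
lemma5 k _ T Z _ = mk⇔ choice⇒path path⇒choice
  where
  budgets : (p : Path {k} {Z} zero (fromℕ k)) →
            (pathCost (+ T) p ≤ + T * (+ k - + 1)) ⇔ (+ T ≤ pathLength p)
  budgets p = cost≤⇔length≥ (pathCost+pathLength-stPath (+ T) p)

  choice⇒path : Σ (Fin k → ℤ) (λ zs → (∀ i → zs i ∈ Z i) × sumFin zs ≡ + T) →
                Σ (Path zero (fromℕ k)) (λ p →
                  (pathLength p ≤ + T) × (pathCost (+ T) p ≤ + T * (+ k - + 1)))
  choice⇒path (zs , zs∈ , zs≡T) with pathOfChoice zs zs∈
  ... | p , p≡zs = p , ≤-reflexive p≡T , Equivalence.from (budgets p) (≤-reflexive (sym p≡T))
    where
    p≡T : pathLength p ≡ + T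
    p≡T = trans p≡zs zs≡T

  path⇒choice : Σ (Path zero (fromℕ k)) (λ p →
                  (pathLength p ≤ + T) × (pathCost (+ T) p ≤ + T * (+ k - + 1))) →
                Σ (Fin k → ℤ) (λ zs → (∀ i → zs i ∈ Z i) × sumFin zs ≡ + T)
  path⇒choice (p , p≤T , cost≤) with choiceOfPath p refl refl
  ... | zs , zs∈ , zs≡p = zs , zs∈ , trans zs≡p (≤-antisym p≤T (Equivalence.to (budgets p) cost≤))
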